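{- Let $\boldsymbol w\in\{0,1\}^\omega$ be a faux-bonacci $\omega$-word. Then $\boldsymbol w=a\varphi(\boldsymbol u)$ for some faux-bonacci $\omega$-word $\boldsymbol u\in\{0,1\}^\omega$ and some $a\in\{\epsilon,1\}$.
   Context: Words are over the binary alphabet $\{0,1\}$; an $\omega$-word is an infinite word $w_1w_2w_3\cdots$ indexed by the positive integers. $\varphi$ is the Fibonacci morphism $\varphi(0)=01$, $\varphi(1)=0$. For a non-empty word $X$, $X^-$ denotes $X$ with its last letter erased. A $4^-$-power is a word of the form $XXXX^-$ with $X$ non-empty (equivalently, a word of period $p$ and length $4p-1$ for some $p\ge 1$). A (finite or infinite) binary word is faux-bonacci (fb) if it contains no factor $11$ and no factor that is a $4^-$-power. -}

module Defs where

open import Data.Nat using (ℕ; zero; suc; _+_)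
open import Data.List using (List; []; _∷_; _++_; _∷ʳ_; length; take)
open import Data.Product using (Σ; ∃; _×_; _,_)
open import Data.Empty using (⊥)
open import Relation.Nullary using (¬_)
open import Relation.Binary.PropositionalEquality using (_≡_)

data Bit : Set where
  b0 b1 : Bit

Word : Set
Word = List Bit

-- ω-words: w₁ w₂ w₃ … is represented with 0-based indexing, w (i) = w_{i+1}.
ωWord : Set
ωWord = ℕ → Bit

shift : ℕ → ωWord → ωWord
shift i w n = w (i + n)

prefix : ℕ → ωWord → Word
prefix zero    w = []
prefix (suc n) w = w 0 ∷ prefix n (λ k → w (suc k))

FactorOfω : Word → ωWord → Set
FactorOfω x w = ∃ λ i → prefix (length x) (shift i w) ≡ x

-- x is a 4⁻-power: x = X X X X⁻ with X non-empty (X = Y b, X⁻ = Y)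
IsFourMinusPower : Word → Set
IsFourMinusPower x =
  Σ Word λ Y → Σ Bit λ b →
    x ≡ (Y ∷ʳ b) ++ (Y ∷ʳ b) ++ (Y ∷ʳ b) ++ Y

FauxBonacciω : ωWord → Set
FauxBonacciω w =
  ¬ FactorOfω (b1 ∷ b1 ∷ []) w ×
  (∀ x → FactorOfω x w → ¬ IsFourMinusPower x)

φ₁ : Bit → Word
φ₁ b0 = b0 ∷ b1 ∷ []
φ₁ b1 = b0 ∷ []

φ : Word → Word
φ []       = []
φ (c ∷ cs) = φ₁ c ++ φ cs

-- Since φ is non-erasing, |a φ(u₁…uₙ)| ≥ n, so the first n letters of
-- a φ(u) are the first n letters of a φ(u₁…uₙ); this pins down a φ(u).
_≡_·φ_ : ωWord → Word → ωWord → Set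
w ≡ a ·φ u = ∀ n → prefix n w ≡ take n (a ++ φ (prefix n u))

{-# OPTIONS --safe #-}
-- A word that starts with 0 and avoids 11 cuts uniquely into blocks 0 = φ(1) and 01 = φ(0),
-- so it is φ(u) where u is read off block by block; a faux-bonacci word is of this form, or is
-- 1 followed by such a word. Every factor x of u occurs in the original word as φ(x)0, the 0
-- opening the next block. Hence 11 in u would give the 4⁻-power 000, and a 4⁻-power x in u
-- gives one in φ(x)0: φ(X1)φ(X1)φ(X1)φ(X) = (φ(X)0)³φ(X) and φ(X0)φ(X0)φ(X0)φ(X)0 = (φ(X)01)³φ(X)0.
module Submission where

open import Defs
open import Data.Nat using (ℕ; zero; suc; _+_; _≤_; z≤n; s≤s)
open import Data.Nat.Properties using (+-assoc; +-comm; +-identityʳ; +-suc; +-mono-≤; ≤-refl; ≤-trans; n≤1+n)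
open import Data.List using ([]; _∷_; _++_; _∷ʳ_; [_]; length; take)
open import Data.List.Properties using (++-assoc; ∷-injectiveˡ; ∷-injectiveʳ)
open import Data.Product using (Σ; _×_; _,_)
open import Data.Sum using (_⊎_; inj₁; inj₂; [_,_]′)
open import Data.Empty using (⊥-elim)
open import Function using (_∘_)
open import Relation.Nullary using (¬_)
open import Relation.Binary.PropositionalEquality
  using (_≡_; refl; sym; trans; cong; cong₂; subst; module ≡-Reasoning)
open ≡-Reasoning

prefix-cong : ∀ n {r s : ωWord} → (∀ i → r i ≡ s i) → prefix n r ≡ prefix n s
prefix-cong zero    r≗s = refl
prefix-cong (suc n) r≗s = cong₂ _∷_ (r≗s 0) (prefix-cong n (λ i → r≗s (suc i)))

prefix-+ : ∀ m n (r : ωWord) → prefix (m + n) r ≡ prefix m r ++ prefix n (shift m r)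
prefix-+ zero    n r = refl
prefix-+ (suc m) n r = cong (r 0 ∷_) (prefix-+ m n (λ i → r (suc i)))

prefix-suc : ∀ n (r : ωWord) → prefix (suc n) r ≡ prefix n r ∷ʳ r n
prefix-suc zero    r = refl
prefix-suc (suc n) r = cong (r 0 ∷_) (prefix-suc n (λ i → r (suc i)))

length-prefix : ∀ n (r : ωWord) → length (prefix n r) ≡ n
length-prefix zero    r = refl
length-prefix (suc n) r = cong suc (length-prefix n (λ i → r (suc i)))

take-prefix : ∀ {m n} (r : ωWord) → m ≤ n → take m (prefix n r) ≡ prefix m r
take-prefix r z≤n       = refl
take-prefix r (s≤s m≤n) = cong (r 0 ∷_) (take-prefix (λ i → r (suc i)) m≤n)

prefix-++⁻ˡ : ∀ xs {ys} (r : ωWord) → prefix (length (xs ++ ys)) r ≡ xs ++ ys → prefix (length xs) r ≡ xs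
prefix-++⁻ˡ []       r p = refl
prefix-++⁻ˡ (x ∷ xs) r p = cong₂ _∷_ (∷-injectiveˡ p) (prefix-++⁻ˡ xs (λ i → r (suc i)) (∷-injectiveʳ p))

prefix⇒factor : ∀ {n x} (r : ωWord) → prefix n r ≡ x → FactorOfω x r
prefix⇒factor {n} r refl = 0 , subst (λ m → prefix m r ≡ prefix n r) (sym (length-prefix n r)) refl

factor-shift : ∀ {x} i (r : ωWord) → FactorOfω x (shift i r) → FactorOfω x r
factor-shift {x} i r (j , p) = i + j , trans (prefix-cong (length x) (λ n → cong r (+-assoc i j n))) p

factor-++⁻ˡ : ∀ xs {ys} {r : ωWord} → FactorOfω (xs ++ ys) r → FactorOfω xs r
factor-++⁻ˡ xs {r = r} (i , p) = i , prefix-++⁻ˡ xs (shift i r) p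

φ-++ : ∀ xs ys → φ (xs ++ ys) ≡ φ xs ++ φ ys
φ-++ []       ys = refl
φ-++ (c ∷ xs) ys = trans (cong (φ₁ c ++_) (φ-++ xs ys)) (sym (++-assoc (φ₁ c) (φ xs) (φ ys)))

fourMinus : Word → Word → Word
fourMinus X Y = X ++ X ++ X ++ Y

φ-fourMinus : ∀ X Y → φ (fourMinus X Y) ≡ fourMinus (φ X) (φ Y)
φ-fourMinus X Y = begin
  φ (X ++ X ++ X ++ Y)           ≡⟨ φ-++ X _ ⟩
  φ X ++ φ (X ++ X ++ Y)         ≡⟨ cong (φ X ++_) (φ-++ X _) ⟩
  φ X ++ φ X ++ φ (X ++ Y)       ≡⟨ cong (λ Z → φ X ++ φ X ++ Z) (φ-++ X Y) ⟩
  φ X ++ φ X ++ φ X ++ φ Y       ∎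

fourMinus-∷ʳ : ∀ X Y c → fourMinus X Y ∷ʳ c ≡ fourMinus X (Y ∷ʳ c)
fourMinus-∷ʳ X Y c = begin
  (X ++ X ++ X ++ Y) ++ [ c ]    ≡⟨ ++-assoc X _ _ ⟩
  X ++ (X ++ X ++ Y) ++ [ c ]    ≡⟨ cong (X ++_) (++-assoc X _ _) ⟩
  X ++ X ++ (X ++ Y) ++ [ c ]    ≡⟨ cong (λ Z → X ++ X ++ Z) (++-assoc X Y _) ⟩
  X ++ X ++ X ++ Y ++ [ c ]      ∎

φ-fourMinusPower : ∀ {x} → IsFourMinusPower x →
                   IsFourMinusPower (φ x) ⊎ IsFourMinusPower (φ x ∷ʳ b0)
φ-fourMinusPower (Y , b1 , refl) =
  inj₁ (φ Y , b0 , trans (φ-fourMinus (Y ∷ʳ b1) Y) (cong (λ X → fourMinus X (φ Y)) (φ-++ Y [ b1 ])))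
φ-fourMinusPower (Y , b0 , refl) = inj₂ (φ Y ∷ʳ b0 , b1 , (begin
  φ (fourMinus (Y ∷ʳ b0) Y) ∷ʳ b0          ≡⟨ cong (_∷ʳ b0) (φ-fourMinus (Y ∷ʳ b0) Y) ⟩
  fourMinus (φ (Y ∷ʳ b0)) (φ Y) ∷ʳ b0      ≡⟨ fourMinus-∷ʳ (φ (Y ∷ʳ b0)) (φ Y) b0 ⟩
  fourMinus (φ (Y ∷ʳ b0)) (φ Y ∷ʳ b0)      ≡⟨ cong (λ X → fourMinus X (φ Y ∷ʳ b0)) φY0 ⟩
  fourMinus (φ Y ∷ʳ b0 ∷ʳ b1) (φ Y ∷ʳ b0)  ∎))
  where
  φY0 : φ (Y ∷ʳ b0) ≡ φ Y ∷ʳ b0 ∷ʳ b1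
  φY0 = trans (φ-++ Y [ b0 ]) (sym (++-assoc (φ Y) [ b0 ] [ b1 ]))

Avoids11 : ωWord → Set
Avoids11 r = ∀ i → r i ≡ b1 → ¬ r (suc i) ≡ b1

FourMinusPowerFree : ωWord → Set
FourMinusPowerFree r = ∀ x → FactorOfω x r → ¬ IsFourMinusPower x

avoids11 : ∀ r → ¬ FactorOfω (b1 ∷ b1 ∷ []) r → Avoids11 r
avoids11 r no11 i ri≡1 rsi≡1 =
  no11 (i , cong₂ _∷_ (trans (cong r (+-identityʳ i)) ri≡1) (cong [_] (trans (cong r (+-comm i 1)) rsi≡1)))

fourMinusPowerFree-shift : ∀ i r → FourMinusPowerFree r → FourMinusPowerFree (shift i r)
fourMinusPowerFree-shift i r free x = free x ∘ factor-shift i r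

avoids11-shift : ∀ i {r} → Avoids11 r → Avoids11 (shift i r)
avoids11-shift i {r} no11 j rj≡1 = no11 (i + j) rj≡1 ∘ subst (λ k → r k ≡ b1) (+-suc i j)

Decodable : ωWord → Set
Decodable r = r 0 ≡ b0 × Avoids11 r

complement : Bit → Bit
complement b0 = b1
complement b1 = b0

≢1⇒≡0 : ∀ {b} → ¬ b ≡ b1 → b ≡ b0
≢1⇒≡0 {b0} _    = refl
≢1⇒≡0 {b1} b≢1 = ⊥-elim (b≢1 refl)

-- The block at the front of a decodable word is 01 exactly when its second letter is 1.
leadingLetter : ωWord → Bit
leadingLetter r = complement (r 1)

dropBlock : ωWord → ωWord
dropBlock r = shift (length (φ₁ (leadingLetter r))) r

decode : ωWord → ωWord
decode r zero    = leadingLetter r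
decode r (suc k) = decode (dropBlock r) k

blockBoundary : ωWord → ℕ → ℕ
blockBoundary r zero    = 0
blockBoundary r (suc k) = length (φ₁ (leadingLetter r)) + blockBoundary (dropBlock r) k

prefix-leadingBlock : ∀ {r} → Decodable r → prefix (length (φ₁ (leadingLetter r))) r ≡ φ₁ (leadingLetter r)
prefix-leadingBlock {r} (r0≡0 , _) with r 1 in r1
... | b0 = cong [_] r0≡0
... | b1 = cong₂ _∷_ r0≡0 (cong [_] r1)

decodable-dropBlock : ∀ {r} → Decodable r → Decodable (dropBlock r)
decodable-dropBlock {r} (_ , no11) with r 1 in r1
... | b0 = r1 , avoids11-shift 1 no11
... | b1 = ≢1⇒≡0 (no11 1 r1) , avoids11-shift 2 no11

blockBoundary-letter : ∀ {r} → Decodable r → ∀ k → r (blockBoundary r k) ≡ b0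
blockBoundary-letter (r0≡0 , _) zero    = r0≡0
blockBoundary-letter d          (suc k) = blockBoundary-letter (decodable-dropBlock d) k

prefix-blockBoundary : ∀ {r} → Decodable r → ∀ k → prefix (blockBoundary r k) r ≡ φ (prefix k (decode r))
prefix-blockBoundary         d zero    = refl
prefix-blockBoundary {r} d (suc k) = begin
  prefix (L + blockBoundary (dropBlock r) k) r
    ≡⟨ prefix-+ L _ r ⟩
  prefix L r ++ prefix (blockBoundary (dropBlock r) k) (dropBlock r)
    ≡⟨ cong₂ _++_ (prefix-leadingBlock d) (prefix-blockBoundary (decodable-dropBlock d) k) ⟩
  φ₁ (leadingLetter r) ++ φ (prefix k (decode (dropBlock r)))  ∎
  where L = length (φ₁ (leadingLetter r))

φ₁-nonempty : ∀ c → 1 ≤ length (φ₁ c)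
φ₁-nonempty b0 = s≤s z≤n
φ₁-nonempty b1 = s≤s z≤n

blockBoundary-≥ : ∀ r k → k ≤ blockBoundary r k
blockBoundary-≥ r zero    = z≤n
blockBoundary-≥ r (suc k) = +-mono-≤ (φ₁-nonempty (leadingLetter r)) (blockBoundary-≥ (dropBlock r) k)

prefix-φ-decode : ∀ {r} → Decodable r → ∀ {m n} → m ≤ n → prefix m r ≡ take m (φ (prefix n (decode r)))
prefix-φ-decode {r} d {m} {n} m≤n = begin
  prefix m r                                 ≡⟨ take-prefix r (≤-trans m≤n (blockBoundary-≥ r n)) ⟨
  take m (prefix (blockBoundary r n) r)      ≡⟨ cong (take m) (prefix-blockBoundary d n) ⟩
  take m (φ (prefix n (decode r)))           ∎

factor-decode : ∀ {r} → Decodable r → ∀ {x} → FactorOfω x (decode r) → FactorOfω (φ x ∷ʳ b0) r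
factor-decode {r} d {x} (zero , p) = prefix⇒factor r (begin
  prefix (suc B) r                            ≡⟨ prefix-suc B r ⟩
  prefix B r ∷ʳ r B                           ≡⟨ cong₂ _∷ʳ_ (prefix-blockBoundary d m) (blockBoundary-letter d m) ⟩
  φ (prefix m (decode r)) ∷ʳ b0               ≡⟨ cong (λ y → φ y ∷ʳ b0) p ⟩
  φ x ∷ʳ b0                                   ∎)
  where
  m = length x
  B = blockBoundary r m
factor-decode {r} d (suc i , p) =
  factor-shift (length (φ₁ (leadingLetter r))) r (factor-decode (decodable-dropBlock d) (i , p))

decode-fauxBonacci : ∀ {r} → Decodable r → FourMinusPowerFree r → FauxBonacciω (decode r)
decode-fauxBonacci {r} d free =
    (λ f → free _ (factor-decode d f) ([] , b0 , refl))
  , λ x f → [ free (φ x) (factor-++⁻ˡ (φ x) {r = r} (factor-decode d f))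
            , free _ (factor-decode d f)
            ]′ ∘ φ-fourMinusPower

theorem5 : (w : ωWord) → FauxBonacciω w →
    Σ ωWord λ u → Σ Word λ a →
      FauxBonacciω u × (a ≡ [] ⊎ a ≡ b1 ∷ []) × (w ≡ a ·φ u)
theorem5 w (no11 , free) with w 0 in w0
... | b0 = decode w , [] , decode-fauxBonacci d free , inj₁ refl , λ n → prefix-φ-decode d ≤-refl
  where
  d : Decodable w
  d = w0 , avoids11 w no11
... | b1 = decode (shift 1 w) , [ b1 ] , decode-fauxBonacci d (fourMinusPowerFree-shift 1 w free) , inj₂ refl , w≡1φ
  where
  d : Decodable (shift 1 w)
  d = ≢1⇒≡0 (avoids11 w no11 0 w0) , avoids11-shift 1 (avoids11 w no11)
  w≡1φ : w ≡ [ b1 ] ·φ decode (shift 1 w)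
  w≡1φ zero    = refl
  w≡1φ (suc n) = cong₂ _∷_ w0 (prefix-φ-decode d (n≤1+n n))
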